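{- Let $0<\alpha<1$ be irrational with continued fraction $[0,a_1,a_2,\ldots]$ and convergent denominators $q_i$. Let $n\ge1$ have lazy Ostrowski representation $n=\sum_{0\le i\le t} d_iq_i$, let $Y_n$ be the length-$n$ prefix of the characteristic Sturmian word $\mathbf{x}_\alpha$, and let $\mathrm{PER}(n)$ be the set of all periods of $Y_n$ (including $n$). Then $\mathrm{PER}(n) \subseteq A(n)$, where $$A(n) = \Bigl\{ e q_j + \sum_{j < i \leq t} d_i q_i : 0 \leq j \leq t,\ 1 \leq e \leq d_j \Bigr\}.$$
   Context: Let $p_i/q_i=[0,a_1,\ldots,a_i]$ be the convergents of $\alpha$, so $q_0=1$, $q_1=a_1$, $q_i=a_iq_{i-1}+q_{i-2}$. The lazy Ostrowski representation of a positive integer $n$ is the (unique) expression $n=\sum_{0\le i\le t} d_i q_i$ with $d_t>0$ satisfying: $0 \le d_0 < a_1$; $0 \le d_i \le a_{i+1}$ for $i\ge1$; for $2 \le i \le t$, if $d_i=0$ then $d_{i-1}=a_i$; and if $d_1=0$ (with $t\ge1$) then $d_0=a_1-1$. The characteristic Sturmian word $\mathbf{x}_\alpha=x_1x_2\cdots$ is given by $x_i=\lfloor (i+1)\alpha\rfloor-\lfloor i\alpha\rfloor$, $i\ge1$. An integer $p$ with $1\le p\le |w|$ is a period of a finite word $w$ if $w[i]=w[i+p]$ for all $1\le i\le |w|-p$. -}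

module Defs where

open import Data.Nat using (ℕ; zero; suc; _+_; _*_; _∸_; _≤_; _<_)
open import Data.Product using (Σ; ∃; _×_; _,_; proj₁; proj₂)
open import Relation.Nullary using (¬_)
open import Relation.Binary.PropositionalEquality using (_≡_)
open import Function.Bundles using (_⇔_)

-- A continued-fraction sequence: a i is the partial quotient a_i for i ≥ 1
-- (a 0 is unused).  alpha = [0; a_1, a_2, ...], infinite, with all a_i ≥ 1,
-- i.e. exactly the irrationals 0 < alpha < 1.

pq : (ℕ → ℕ) → ℕ → ℕ × ℕ
pq a zero = 0 , 1
pq a (suc zero) = 1 , a 1
pq a (suc (suc i)) =
  a (suc (suc i)) * proj₁ (pq a (suc i)) + proj₁ (pq a i) ,
  a (suc (suc i)) * proj₂ (pq a (suc i)) + proj₂ (pq a i)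

p : (ℕ → ℕ) → ℕ → ℕ
p a i = proj₁ (pq a i)

q : (ℕ → ℕ) → ℕ → ℕ
q a i = proj₂ (pq a i)

-- Below a m i  :⇔  m < i·alpha, where alpha = [0; a_1, a_2, ...] is the limit
-- of the convergents.  Even convergents increase strictly to alpha, so for
-- a rational m/i:  m/i < alpha  iff  m/i < p_{2k}/q_{2k} for some k.
Below : (ℕ → ℕ) → ℕ → ℕ → Set
Below a m i = ∃ λ k → m * q a (2 * k) < i * p a (2 * k)

-- The i-th letter (i ≥ 1) of the characteristic Sturmian word x_alpha,
-- x_i = ⌊(i+1)alpha⌋ - ⌊i alpha⌋ ∈ {0,1}.  Since 0 < alpha < 1 is irrational,
-- x_i = 1 iff there is an integer m with i·alpha < m < (i+1)·alpha.
-- XOne a i is the proposition "x_i = 1".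
XOne : (ℕ → ℕ) → ℕ → Set
XOne a i = ∃ λ m → Below a m (suc i) × ¬ Below a m i

sumBelow : (ℕ → ℕ) → ℕ → ℕ
sumBelow f zero = 0
sumBelow f (suc k) = sumBelow f k + f k

LazyOstrowski : (ℕ → ℕ) → ℕ → ℕ → (ℕ → ℕ) → Set
LazyOstrowski a n t d =
  (sumBelow (λ i → d i * q a i) (suc t) ≡ n)
  × (0 < d t)
  × (d 0 < a 1)
  × (∀ i → 1 ≤ i → i ≤ t → d i ≤ a (suc i))
  × (∀ i → 2 ≤ i → i ≤ t → d i ≡ 0 → d (i ∸ 1) ≡ a i)
  × (1 ≤ t → d 1 ≡ 0 → d 0 ≡ a 1 ∸ 1)

IsPeriodOfPrefix : (ℕ → ℕ) → ℕ → ℕ → Set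
IsPeriodOfPrefix a n per =
  (1 ≤ per) × (per ≤ n) ×
  (∀ i → 1 ≤ i → i + per ≤ n → (XOne a i ⇔ XOne a (i + per)))

InA : (ℕ → ℕ) → ℕ → (ℕ → ℕ) → ℕ → Set
InA a t d per =
  ∃ λ j → ∃ λ e → (j ≤ t) × (1 ≤ e) × (e ≤ d j) ×
    (per ≡ e * q a j + sumBelow (λ k → d (suc j + k) * q a (suc j + k)) (t ∸ j))

{-# OPTIONS --safe #-}
-- Fix an even index K with q_K > n + 1 and put P/Q = p_K/q_K.  Even convergents increase
-- to α and no fraction with denominator below Q lies strictly between p_K/q_K and p_{K+1}/q_{K+1},
-- so Y_n is a prefix of the rational word of slope P/Q: its i-th letter is the carry c(i, 1) in the
-- addition of the residues r(i) = iP mod Q and r(1).  The identity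
-- c(i + p, 1) + c(i, p) = c(i + 1, p) + c(i, 1) shows that p is a period of Y_n iff c(j, p) is
-- constant for 1 ≤ j ≤ n + 1 − p.  Expanding (j, m) in the unimodular basis of two consecutive
-- convergents gives ρ_t ≤ r(j) ≤ Q − ρ_t for 0 < j < q_{t+1}, where ρ_t = |q_t P − p_t Q|, while
-- r(q_t) is ρ_t or Q − ρ_t according to the parity of t.  Hence c(j, q_t) is the parity of t on
-- that range, so q_t is a period when q_t ≤ n ≤ q_{t+1} + q_t − 2, and no p < q_t is a period
-- when q_t + q_{t−1} ≤ n + 1.  For n with lazy representation of top index t both apply: every
-- period is q_t or q_t plus a period of Y_{n − q_t}, and induction along the digits gives A(n).

module Submission where

open import Defs
open import Data.Nat
open import Data.Nat.Properties
open import Data.Nat.DivMod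
open import Data.Nat.Divisibility using (_∣_; ∣-trans; m∣m*n; ∣m+n∣m⇒∣n; ∣1⇒≡1; m%n≡0⇒n∣m; ∣⇒≤)
open import Data.Nat.Coprimality using (Coprime; coprime-divisor)
open import Data.Nat.Tactic.RingSolver using (solve)
open import Data.List using (_∷_; [])
open import Data.Product
open import Data.Sum using (_⊎_; inj₁; inj₂)
import Data.Sum as Sum
open import Data.Empty using (⊥; ⊥-elim)
open import Relation.Nullary using (¬_; yes; no)
open import Relation.Binary.PropositionalEquality
open import Relation.Binary.Definitions using (tri<; tri≈; tri>)
open import Function.Base using (_∘_)
open import Function.Bundles using (_⇔_; mk⇔; Equivalence)
import Function.Properties.Equivalence as ⇔
open import Algebra.Properties.CommutativeSemigroup +-commutativeSemigroup
  using (xy∙z≈xz∙y; x∙yz≈y∙xz; x∙yz≈y∙zx; xy∙z≈zy∙x)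

data Even : ℕ → Set
data Odd : ℕ → Set

data Even where
  zero : Even zero
  suc  : ∀ {n} → Odd n → Even (suc n)

data Odd where
  suc : ∀ {n} → Even n → Odd (suc n)

even-or-odd : ∀ n → Even n ⊎ Odd n
even-or-odd zero = inj₁ zero
even-or-odd (suc n) with even-or-odd n
... | inj₁ e = inj₂ (suc e)
... | inj₂ o = inj₁ (suc o)

even-double : ∀ h → Even (2 * h)
even-double zero = zero
even-double (suc h) rewrite +-suc h (h + 0) = suc (suc (even-double h))

Period : (ℕ → Set) → ℕ → ℕ → Set
Period W n p = 1 ≤ p × p ≤ n × (∀ i → 1 ≤ i → i + p ≤ n → (W i ⇔ W (i + p)))

period-difference : ∀ {W n p p′} → Period W n p → Period W n p′ → p < p′ →
                    Period W (n ∸ p) (p′ ∸ p)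
period-difference {W} {n} {p} {p′} (_ , p≤n , per) (_ , p′≤n , per′) p<p′ =
  m<n⇒0<n∸m p<p′ , ∸-monoˡ-≤ p p′≤n , shifted
  where
  shifted : ∀ i → 1 ≤ i → i + (p′ ∸ p) ≤ n ∸ p → W i ⇔ W (i + (p′ ∸ p))
  shifted i 1≤i i+d≤n-p =
    ⇔.trans (subst (λ k → W i ⇔ W k) (sym same)
                   (per′ i 1≤i (≤-trans (≤-reflexive (sym same)) in-range)))
            (⇔.sym (per (i + (p′ ∸ p)) (≤-trans 1≤i (m≤m+n i _)) in-range))
    where
    same : i + (p′ ∸ p) + p ≡ i + p′
    same = trans (+-assoc i _ p) (cong (i +_) (m∸n+n≡m (<⇒≤ p<p′)))
    in-range : i + (p′ ∸ p) + p ≤ n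
    in-range = ≤-trans (+-monoˡ-≤ p i+d≤n-p) (≤-reflexive (m∸n+n≡m p≤n))

bit-≡ : ∀ {b c} → b ≤ 1 → c ≤ 1 → (b ≡ 1 ⇔ c ≡ 1) → b ≡ c
bit-≡ {0} {0} _ _ _ = refl
bit-≡ {0} {1} _ _ b⇔c = ⊥-elim (0≢1+n (Equivalence.from b⇔c refl))
bit-≡ {1} {0} _ _ b⇔c = ⊥-elim (0≢1+n (Equivalence.to b⇔c refl))
bit-≡ {1} {1} _ _ _ = refl
bit-≡ {suc (suc _)} (s≤s ())
bit-≡ {_} {suc (suc _)} _ (s≤s ())

cross-cancel : ∀ {a b c d : ℕ} → a + b ≡ c + d → a ≡ d → c ≡ b
cross-cancel {a} {b} {c} {d} eq refl = sym (+-cancelˡ-≡ a b c (trans eq (+-comm c a)))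

gap-pos : ∀ {x y r} → x < y → y ≡ x + r → 0 < r
gap-pos {x} {r = zero} x<y refl = ⊥-elim (<-irrefl (sym (+-identityʳ x)) x<y)
gap-pos {r = suc r} _ _ = s≤s z≤n

module Residues (P Q : ℕ) .{{_ : NonZero Q}} where

  residue : ℕ → ℕ
  residue j = j * P % Q

  carry : ℕ → ℕ → ℕ
  carry x y = (residue x + residue y) / Q

  residue<Q : ∀ j → residue j < Q
  residue<Q j = m%n<n (j * P) Q

  division : ∀ j → j * P ≡ residue j + j * P / Q * Q
  division j = m≡m%n+[m/n]*n (j * P) Q

  residue-+ : ∀ x y → residue (x + y) + carry x y * Q ≡ residue x + residue y
  residue-+ x y = begin
    residue (x + y) + carry x y * Q ≡⟨ cong (_+ carry x y * Q) residue-sum ⟩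
    s % Q + s / Q * Q               ≡⟨ sym (m≡m%n+[m/n]*n s Q) ⟩
    s                               ∎
    where
    open ≡-Reasoning
    s : ℕ
    s = residue x + residue y
    residue-sum : residue (x + y) ≡ s % Q
    residue-sum = trans (cong (_% Q) (*-distribʳ-+ P x y)) (%-distribˡ-+ (x * P) (y * P) Q)

  carry≤1 : ∀ x y → carry x y ≤ 1
  carry≤1 x y = ≤-pred (m<n*o⇒m/o<n (≤-trans (+-mono-< (residue<Q x) (residue<Q y))
                                              (≤-reflexive (cong (Q +_) (sym (+-identityʳ Q))))))

  carry≡0 : ∀ x y → residue x + residue y < Q → carry x y ≡ 0
  carry≡0 x y = m<n⇒m/n≡0

  carry≡1 : ∀ x y → Q ≤ residue x + residue y → carry x y ≡ 1
  carry≡1 x y Q≤s = ≤-antisym (carry≤1 x y) (m≥n⇒m/n>0 Q≤s)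

  residue-+₃ : ∀ x y z → residue (x + y + z) + (carry (x + y) z + carry x y) * Q ≡
                         residue x + residue y + residue z
  residue-+₃ x y z = begin
    residue (x + y + z) + (carry (x + y) z + carry x y) * Q
      ≡⟨ cong (residue (x + y + z) +_) (*-distribʳ-+ Q (carry (x + y) z) (carry x y)) ⟩
    residue (x + y + z) + (carry (x + y) z * Q + carry x y * Q)
      ≡⟨ sym (+-assoc (residue (x + y + z)) _ _) ⟩
    residue (x + y + z) + carry (x + y) z * Q + carry x y * Q
      ≡⟨ cong (_+ carry x y * Q) (residue-+ (x + y) z) ⟩
    residue (x + y) + residue z + carry x y * Q
      ≡⟨ xy∙z≈xz∙y (residue (x + y)) (residue z) _ ⟩
    residue (x + y) + carry x y * Q + residue z
      ≡⟨ cong (_+ residue z) (residue-+ x y) ⟩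
    residue x + residue y + residue z ∎
    where open ≡-Reasoning

  carry-comm : ∀ x y → carry x y ≡ carry y x
  carry-comm x y = cong (_/ Q) (+-comm (residue x) (residue y))

  residue-+≡0 : ∀ x y → residue x + residue y ≡ Q → residue (x + y) ≡ 0
  residue-+≡0 x y sum≡Q = +-cancelʳ-≡ Q _ 0 (begin
    residue (x + y) + Q             ≡⟨ cong (residue (x + y) +_) (*-identityˡ Q) ⟨
    residue (x + y) + 1 * Q         ≡⟨ cong (λ c → residue (x + y) + c * Q) carry≡1′ ⟨
    residue (x + y) + carry x y * Q ≡⟨ residue-+ x y ⟩
    residue x + residue y           ≡⟨ sum≡Q ⟩
    Q                               ∎)
    where
    open ≡-Reasoning
    carry≡1′ : carry x y ≡ 1
    carry≡1′ = carry≡1 x y (≤-reflexive (sym sum≡Q))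

  carry-exchange : ∀ x y z → carry (x + y) z + carry x y ≡ carry (x + z) y + carry x z
  carry-exchange x y z = *-cancelʳ-≡ _ _ Q (+-cancelˡ-≡ (residue (x + y + z)) _ _ (begin
    residue (x + y + z) + (carry (x + y) z + carry x y) * Q ≡⟨ residue-+₃ x y z ⟩
    residue x + residue y + residue z                       ≡⟨ xy∙z≈xz∙y (residue x) (residue y) _ ⟩
    residue x + residue z + residue y                       ≡⟨ residue-+₃ x z y ⟨
    residue (x + z + y) + (carry (x + z) y + carry x z) * Q
      ≡⟨ cong (λ k → residue k + (carry (x + z) y + carry x z) * Q) (xy∙z≈xz∙y x z y) ⟩
    residue (x + y + z) + (carry (x + z) y + carry x z) * Q ∎))
    where open ≡-Reasoning

  carry-step : ∀ i p → carry (i + p) 1 + carry i p ≡ carry (suc i) p + carry i 1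
  carry-step i p = trans (carry-exchange i p 1) (cong (λ k → carry k p + carry i 1) (+-comm i 1))

  residue-of : ∀ j {m r} → j * P ≡ m * Q + r → r < Q → residue j ≡ r
  residue-of j {m} {r} eq r<Q = begin
    j * P % Q       ≡⟨ cong (_% Q) (trans eq (+-comm (m * Q) r)) ⟩
    (r + m * Q) % Q ≡⟨ [m+kn]%n≡m%n r m Q ⟩
    r % Q           ≡⟨ m<n⇒m%n≡m r<Q ⟩
    r               ∎
    where open ≡-Reasoning

  residue-of-deficit : ∀ j {m r} → j * P + r ≡ m * Q → 0 < r → r ≤ Q → residue j ≡ Q ∸ r
  residue-of-deficit j {zero} {suc r} eq _ _ = ⊥-elim (m+1+n≢0 (j * P) eq)
  residue-of-deficit j {suc m} {r} eq 0<r r≤Q =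
    residue-of j {m} (+-cancelʳ-≡ r _ _ (begin
      j * P + r         ≡⟨ eq ⟩
      Q + m * Q         ≡⟨ cong (_+ m * Q) (sym (m∸n+n≡m r≤Q)) ⟩
      Q ∸ r + r + m * Q ≡⟨ xy∙z≈xz∙y (Q ∸ r) r (m * Q) ⟩
      Q ∸ r + m * Q + r ≡⟨ cong (_+ r) (+-comm (Q ∸ r) (m * Q)) ⟩
      m * Q + (Q ∸ r) + r ∎))
      (∸-monoʳ-< 0<r r≤Q)
    where open ≡-Reasoning

  residue-nonzero : Coprime Q P → ∀ j → 0 < j → j < Q → residue j ≢ 0
  residue-nonzero coprime j 0<j j<Q residue≡0 = <⇒≱ j<Q (∣⇒≤ {{>-nonZero 0<j}} Q∣j)
    where
    Q∣j : Q ∣ j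
    Q∣j = coprime-divisor coprime (subst (Q ∣_) (*-comm j P) (m%n≡0⇒n∣m (j * P) Q residue≡0))

  separated⇒residue-bounds : ∀ j {r} → 0 < r → (∀ m → m * Q + r ≤ j * P ⊎ j * P + r ≤ m * Q) →
                   r ≤ residue j × residue j + r ≤ Q
  separated⇒residue-bounds j {r} 0<r separated = lower (separated f) , upper (separated (suc f))
    where
    open ≤-Reasoning
    f : ℕ
    f = j * P / Q
    lower : f * Q + r ≤ j * P ⊎ j * P + r ≤ f * Q → r ≤ residue j
    lower (inj₁ fQ+r≤jP) = +-cancelˡ-≤ (f * Q) r (residue j)
      (≤-trans fQ+r≤jP (≤-reflexive (trans (division j) (+-comm (residue j) (f * Q)))))
    lower (inj₂ jP+r≤fQ) = ⊥-elim (<⇒≱ (≤-<-trans (m/n*n≤m (j * P) Q) (m<m+n (j * P) 0<r)) jP+r≤fQ)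
    upper : suc f * Q + r ≤ j * P ⊎ j * P + r ≤ suc f * Q → residue j + r ≤ Q
    upper (inj₁ fQ+Q+r≤jP) = ⊥-elim (<⇒≱ (begin-strict
      j * P             ≡⟨ division j ⟩
      residue j + f * Q <⟨ +-monoˡ-< (f * Q) (residue<Q j) ⟩
      Q + f * Q         ≤⟨ m≤m+n (Q + f * Q) r ⟩
      suc f * Q + r     ∎) fQ+Q+r≤jP)
    upper (inj₂ jP+r≤fQ+Q) = +-cancelʳ-≤ (f * Q) (residue j + r) Q (begin
      residue j + r + f * Q ≡⟨ xy∙z≈xz∙y (residue j) r (f * Q) ⟩
      residue j + f * Q + r ≡⟨ cong (_+ r) (division j) ⟨
      j * P + r             ≤⟨ jP+r≤fQ+Q ⟩
      Q + f * Q             ∎)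

  residue-one : P < Q → residue 1 ≡ P
  residue-one P<Q = residue-of 1 {0} (+-identityʳ P) P<Q

  carry≡1⇔ : ∀ x y → residue (x + y) ≢ 0 → carry x y ≡ 1 ⇔ Q < residue x + residue y
  carry≡1⇔ x y residue≢0 = mk⇔
    (λ carry≡1 → ≤∧≢⇒< (m/n≢0⇒n≤m (λ carry≡0 → 0≢1+n (trans (sym carry≡0) carry≡1)))
                       (residue≢0 ∘ residue-+≡0 x y ∘ sym))
    (carry≡1 x y ∘ <⇒≤)

  multiple-between⇔ : ∀ i → residue i ≢ 0 →
    (∃ λ m → m * Q < suc i * P × ¬ m * Q < i * P) ⇔ Q < residue i + P
  multiple-between⇔ i residue≢0 = mk⇔ to from
    where
    open ≤-Reasoning
    f : ℕ
    f = i * P / Q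
    next : suc i * P ≡ residue i + P + f * Q
    next = trans (cong (P +_) (division i)) (trans (sym (+-assoc P _ _)) (cong (_+ f * Q) (+-comm P (residue i))))
    to : (∃ λ m → m * Q < suc i * P × ¬ m * Q < i * P) → Q < residue i + P
    to (m , mQ<iP+P , mQ≮iP) = +-cancelʳ-< (f * Q) Q _ (begin-strict
      Q + f * Q             ≤⟨ *-monoˡ-≤ Q f<m ⟩
      m * Q                 <⟨ mQ<iP+P ⟩
      suc i * P             ≡⟨ next ⟩
      residue i + P + f * Q ∎)
      where
      f<m : f < m
      f<m = *-cancelʳ-< Q f m (begin-strict
        f * Q             <⟨ m<n+m (f * Q) (n≢0⇒n>0 residue≢0) ⟩
        residue i + f * Q ≡⟨ division i ⟨
        i * P             ≤⟨ ≮⇒≥ mQ≮iP ⟩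
        m * Q             ∎)
    from : Q < residue i + P → ∃ λ m → m * Q < suc i * P × ¬ m * Q < i * P
    from Q<s = suc f , fQ+Q<iP+P , λ fQ+Q<iP → <⇒≱ fQ+Q<iP (begin
      i * P             ≡⟨ division i ⟩
      residue i + f * Q ≤⟨ +-monoˡ-≤ (f * Q) (<⇒≤ (residue<Q i)) ⟩
      Q + f * Q         ∎)
      where
      fQ+Q<iP+P : Q + f * Q < suc i * P
      fQ+Q<iP+P = begin-strict
        Q + f * Q             <⟨ +-monoˡ-< (f * Q) Q<s ⟩
        residue i + P + f * Q ≡⟨ next ⟨
        suc i * P             ∎

  Encodes : (ℕ → Set) → ℕ → Set
  Encodes W n = ∀ {i} → 1 ≤ i → i ≤ n → W i ⇔ carry i 1 ≡ 1

  period-from-carries : ∀ {W n p b} → Encodes W n → 1 ≤ p → p ≤ n →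
                        (∀ {j} → 1 ≤ j → j + p ≤ suc n → carry j p ≡ b) → Period W n p
  period-from-carries {W} {n} {p} enc 1≤p p≤n constant = 1≤p , p≤n , shift
    where
    shift : ∀ i → 1 ≤ i → i + p ≤ n → W i ⇔ W (i + p)
    shift i 1≤i i+p≤n =
      ⇔.trans (enc 1≤i (≤-trans (m≤m+n i p) i+p≤n))
              (⇔.trans (mk⇔ (trans same-letter) (trans (sym same-letter)))
                       (⇔.sym (enc (≤-trans 1≤i (m≤m+n i p)) i+p≤n)))
      where
      same-letter : carry (i + p) 1 ≡ carry i 1
      same-letter = cross-cancel (sym (carry-step i p))
        (trans (constant (s≤s z≤n) (s≤s i+p≤n)) (sym (constant 1≤i (≤-trans i+p≤n (n≤1+n n)))))

  carries-from-period : ∀ {W n p} → Encodes W n → Period W n p →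
                        ∀ {j} → 1 ≤ j → j + p ≤ suc n → carry j p ≡ carry 1 p
  carries-from-period enc per {suc zero} _ _ = refl
  carries-from-period {W} {n} {p} enc per@(_ , _ , shift) {suc (suc j)} _ j+p≤1+n =
    trans (cross-cancel (carry-step (suc j) p) same-letter)
          (carries-from-period enc per (s≤s z≤n) (≤-trans (n≤1+n _) j+p≤1+n))
    where
    i+p≤n : suc j + p ≤ n
    i+p≤n = ≤-pred j+p≤1+n
    same-letter : carry (suc j + p) 1 ≡ carry (suc j) 1
    same-letter = sym (bit-≡ (carry≤1 (suc j) 1) (carry≤1 (suc j + p) 1)
      (⇔.trans (⇔.sym (enc (s≤s z≤n) (≤-trans (m≤m+n (suc j) p) i+p≤n)))
               (⇔.trans (shift (suc j) (s≤s z≤n) i+p≤n) (enc (s≤s z≤n) i+p≤n))))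

  period-shifts-carry : ∀ {W n p} → Encodes W n → Period W n p →
                        ∀ {j} y → 0 < j → j + y + p ≤ suc n → carry (j + p) y ≡ carry j y
  period-shifts-carry {W} {n} {p} enc period {j} y 0<j j+y+p≤1+n =
    cross-cancel (sym (carry-exchange j p y)) (trans at-j+y (sym at-j))
    where
    at-j : carry j p ≡ carry 1 p
    at-j = carries-from-period enc period 0<j (≤-trans (+-monoˡ-≤ p (m≤m+n j y)) j+y+p≤1+n)
    at-j+y : carry (j + y) p ≡ carry 1 p
    at-j+y = carries-from-period enc period (≤-trans 0<j (m≤m+n j y)) j+y+p≤1+n

determinant-step : ∀ A x₀ y₀ x₁ y₁ → y₀ * x₁ ≡ 1 + x₀ * y₁ →
                   x₁ * (A * y₁ + y₀) ≡ 1 + y₁ * (A * x₁ + x₀)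
determinant-step A x₀ y₀ x₁ y₁ det = begin
  x₁ * (A * y₁ + y₀)          ≡⟨ solve (A ∷ y₀ ∷ x₁ ∷ y₁ ∷ []) ⟩
  A * x₁ * y₁ + y₀ * x₁       ≡⟨ cong (A * x₁ * y₁ +_) det ⟩
  A * x₁ * y₁ + (1 + x₀ * y₁) ≡⟨ solve (A ∷ x₀ ∷ x₁ ∷ y₁ ∷ []) ⟩
  1 + y₁ * (A * x₁ + x₀)      ∎
  where open ≡-Reasoning

coprime-by-determinant : ∀ {m n x y} → m * x ≡ 1 + n * y → Coprime m n
coprime-by-determinant {m} {n} {x} {y} det {d} (d∣m , d∣n) =
  ∣1⇒≡1 (∣m+n∣m⇒∣n (subst (d ∣_) (trans det (+-comm 1 (n * y))) (∣-trans d∣m (m∣m*n x)))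
                    (∣-trans d∣n (m∣m*n y)))

cross-multiply : ∀ {m i x y P Q} .{{_ : NonZero Q}} → m * y < i * x → x * Q ≤ y * P → m * Q < i * P
cross-multiply {m} {i} {x} {y} {P} {Q} my<ix xQ≤yP = *-cancelˡ-< y (m * Q) (i * P) (begin-strict
  y * (m * Q) ≡⟨ solve (m ∷ y ∷ Q ∷ []) ⟩
  m * y * Q   <⟨ *-monoˡ-< Q my<ix ⟩
  i * x * Q   ≡⟨ solve (i ∷ x ∷ Q ∷ []) ⟩
  i * (x * Q) ≤⟨ *-monoʳ-≤ i xQ≤yP ⟩
  i * (y * P) ≡⟨ solve (i ∷ y ∷ P ∷ []) ⟩
  y * (i * P) ∎)
  where open ≤-Reasoning

farey-gap : ∀ {m i P Q P′ Q′} → Q * P′ ≡ 1 + P * Q′ →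
            i * P ≤ m * Q → m * Q′ < i * P′ → Q ≤ i
farey-gap {m} {i} {P} {Q} {P′} {Q′} det iP≤mQ mQ′<iP′ = +-cancelʳ-≤ (m * Q * Q′) Q i (begin
  Q + m * Q * Q′   ≡⟨ solve (m ∷ Q ∷ Q′ ∷ []) ⟩
  Q * (1 + m * Q′) ≤⟨ *-monoʳ-≤ Q mQ′<iP′ ⟩
  Q * (i * P′)     ≡⟨ solve (i ∷ Q ∷ P′ ∷ []) ⟩
  i * (Q * P′)     ≡⟨ cong (i *_) det ⟩
  i * (1 + P * Q′) ≡⟨ solve (i ∷ P ∷ Q′ ∷ []) ⟩
  i + i * P * Q′   ≤⟨ +-monoʳ-≤ i (*-monoˡ-≤ Q′ iP≤mQ) ⟩
  i + m * Q * Q′   ∎)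
  where open ≤-Reasoning

unimodular-solve : ∀ {x₀ y₀ x₁ y₁ P Q r₀ r₁} →
  x₀ * P ≡ y₀ * Q + r₀ → y₁ * Q ≡ x₁ * P + r₁ → x₀ * y₁ ≡ 1 + y₀ * x₁ →
  P ≡ y₁ * r₀ + y₀ * r₁ × Q ≡ x₁ * r₀ + x₀ * r₁
unimodular-solve {x₀} {y₀} {x₁} {y₁} {P} {Q} {r₀} {r₁} e₀ e₁ det =
  +-cancelʳ-≡ (y₀ * x₁ * P + y₀ * y₁ * Q) _ _ (begin
    P + (y₀ * x₁ * P + y₀ * y₁ * Q)                 ≡⟨ solve (y₀ ∷ x₁ ∷ y₁ ∷ P ∷ Q ∷ []) ⟩
    (1 + y₀ * x₁) * P + y₀ * y₁ * Q                 ≡⟨ cong (λ d → d * P + y₀ * y₁ * Q) det ⟨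
    x₀ * y₁ * P + y₀ * y₁ * Q                       ≡⟨ solve (x₀ ∷ y₀ ∷ y₁ ∷ P ∷ Q ∷ []) ⟩
    y₁ * (x₀ * P) + y₀ * (y₁ * Q)                   ≡⟨ cong₂ (λ u v → y₁ * u + y₀ * v) e₀ e₁ ⟩
    y₁ * (y₀ * Q + r₀) + y₀ * (x₁ * P + r₁)         ≡⟨ solve (y₀ ∷ x₁ ∷ y₁ ∷ P ∷ Q ∷ r₀ ∷ r₁ ∷ []) ⟩
    y₁ * r₀ + y₀ * r₁ + (y₀ * x₁ * P + y₀ * y₁ * Q) ∎) ,
  +-cancelʳ-≡ (x₁ * y₀ * Q + x₀ * x₁ * P) _ _ (begin
    Q + (x₁ * y₀ * Q + x₀ * x₁ * P)                 ≡⟨ solve (x₀ ∷ y₀ ∷ x₁ ∷ P ∷ Q ∷ []) ⟩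
    (1 + y₀ * x₁) * Q + x₀ * x₁ * P                 ≡⟨ cong (λ d → d * Q + x₀ * x₁ * P) det ⟨
    x₀ * y₁ * Q + x₀ * x₁ * P                       ≡⟨ solve (x₀ ∷ x₁ ∷ y₁ ∷ P ∷ Q ∷ []) ⟩
    x₁ * (x₀ * P) + x₀ * (y₁ * Q)                   ≡⟨ cong₂ (λ u v → x₁ * u + x₀ * v) e₀ e₁ ⟩
    x₁ * (y₀ * Q + r₀) + x₀ * (x₁ * P + r₁)         ≡⟨ solve (x₀ ∷ y₀ ∷ x₁ ∷ P ∷ Q ∷ r₀ ∷ r₁ ∷ []) ⟩
    x₁ * r₀ + x₀ * r₁ + (x₁ * y₀ * Q + x₀ * x₁ * P) ∎)
  where open ≡-Reasoning

-- With u = A − B and v = C − D in ℤ the hypothesis reads u x₀ + v x₁ = j.  As 0 < j < x₁, u ≠ 0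
-- and u, v do not have the same sign, so the two combinations differ by at least r₀.
unimodular-separation : ∀ {x₀ x₁ j A B C D r₀ r₁} → 0 < j → j < x₁ →
  A * x₀ + C * x₁ ≡ j + B * x₀ + D * x₁ →
  B * r₀ + C * r₁ + r₀ ≤ A * r₀ + D * r₁ ⊎ A * r₀ + D * r₁ + r₀ ≤ B * r₀ + C * r₁
unimodular-separation {x₀} {x₁} {j} {A} {B} {C} {D} {r₀} {r₁} 0<j j<x₁ lattice with C ≤? D
... | yes C≤D = inj₁ (begin
  B * r₀ + C * r₁ + r₀ ≡⟨ solve (B ∷ C ∷ r₀ ∷ r₁ ∷ []) ⟩
  suc B * r₀ + C * r₁  ≤⟨ +-mono-≤ (*-monoˡ-≤ r₀ B<A) (*-monoˡ-≤ r₁ C≤D) ⟩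
  A * r₀ + D * r₁      ∎)
  where
  open ≤-Reasoning
  B<A : B < A
  B<A = *-cancelʳ-< x₀ B A (+-cancelʳ-< (C * x₁) (B * x₀) (A * x₀) (begin-strict
    B * x₀ + C * x₁       <⟨ m<n+m _ 0<j ⟩
    j + (B * x₀ + C * x₁) ≤⟨ +-monoʳ-≤ j (+-monoʳ-≤ (B * x₀) (*-monoˡ-≤ x₁ C≤D)) ⟩
    j + (B * x₀ + D * x₁) ≡⟨ +-assoc j _ _ ⟨
    j + B * x₀ + D * x₁   ≡⟨ lattice ⟨
    A * x₀ + C * x₁       ∎))
... | no C≰D = inj₂ (begin
  A * r₀ + D * r₁ + r₀ ≡⟨ solve (A ∷ D ∷ r₀ ∷ r₁ ∷ []) ⟩
  suc A * r₀ + D * r₁  ≤⟨ +-mono-≤ (*-monoˡ-≤ r₀ A<B) (*-monoˡ-≤ r₁ (<⇒≤ D<C)) ⟩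
  B * r₀ + C * r₁      ∎)
  where
  open ≤-Reasoning
  D<C : D < C
  D<C = ≰⇒> C≰D
  A<B : A < B
  A<B = *-cancelʳ-< x₀ A B (+-cancelʳ-< (x₁ + D * x₁) (A * x₀) (B * x₀) (begin-strict
    A * x₀ + (x₁ + D * x₁) ≤⟨ +-monoʳ-≤ (A * x₀) (*-monoˡ-≤ x₁ D<C) ⟩
    A * x₀ + C * x₁        ≡⟨ lattice ⟩
    j + B * x₀ + D * x₁    <⟨ +-monoˡ-< (D * x₁) (+-monoˡ-< (B * x₀) j<x₁) ⟩
    x₁ + B * x₀ + D * x₁   ≡⟨ solve (x₀ ∷ x₁ ∷ B ∷ D ∷ []) ⟩
    B * x₀ + (x₁ + D * x₁) ∎))

lattice-even : ∀ j m {x₀ y₀ x₁ y₁} → x₀ * y₁ ≡ 1 + y₀ * x₁ →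
               j * y₁ * x₀ + m * x₀ * x₁ ≡ j + m * x₁ * x₀ + j * y₀ * x₁
lattice-even j m {x₀} {y₀} {x₁} {y₁} det = begin
  j * y₁ * x₀ + m * x₀ * x₁       ≡⟨ solve (j ∷ m ∷ x₀ ∷ x₁ ∷ y₁ ∷ []) ⟩
  j * (x₀ * y₁) + m * x₁ * x₀     ≡⟨ cong (λ d → j * d + m * x₁ * x₀) det ⟩
  j * (1 + y₀ * x₁) + m * x₁ * x₀ ≡⟨ solve (j ∷ m ∷ x₀ ∷ y₀ ∷ x₁ ∷ []) ⟩
  j + m * x₁ * x₀ + j * y₀ * x₁   ∎
  where open ≡-Reasoning

lattice-odd : ∀ j m {x₀ y₀ x₁ y₁} → y₀ * x₁ ≡ 1 + x₀ * y₁ →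
              m * x₁ * x₀ + j * y₀ * x₁ ≡ j + j * y₁ * x₀ + m * x₀ * x₁
lattice-odd j m {x₀} {y₀} {x₁} {y₁} det = begin
  m * x₁ * x₀ + j * y₀ * x₁       ≡⟨ solve (j ∷ m ∷ x₀ ∷ y₀ ∷ x₁ ∷ []) ⟩
  j * (y₀ * x₁) + m * x₀ * x₁     ≡⟨ cong (λ d → j * d + m * x₀ * x₁) det ⟩
  j * (1 + x₀ * y₁) + m * x₀ * x₁ ≡⟨ solve (j ∷ m ∷ x₀ ∷ x₁ ∷ y₁ ∷ []) ⟩
  j + j * y₁ * x₀ + m * x₀ * x₁   ∎
  where open ≡-Reasoning

module Convergents (a : ℕ → ℕ) (a-pos : ∀ i → 1 ≤ a (suc i)) where

  q-pos : ∀ k → 0 < q a k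
  q-pos 0 = s≤s z≤n
  q-pos 1 = a-pos 0
  q-pos (suc (suc k)) = ≤-trans (q-pos k) (m≤n+m (q a k) _)

  q+q≤q : ∀ k → q a (suc k) + q a k ≤ q a (suc (suc k))
  q+q≤q k = +-monoˡ-≤ (q a k) (m≤n*m (q a (suc k)) _ {{>-nonZero (a-pos (suc k))}})

  n≤q : ∀ k → k ≤ q a k
  n≤q 0 = z≤n
  n≤q 1 = a-pos 0
  n≤q (suc (suc k)) = ≤-trans (≤-reflexive (+-comm 1 (suc k)))
                              (≤-trans (+-mono-≤ (n≤q (suc k)) (q-pos k)) (q+q≤q k))

  det-even : ∀ {k} → Even k → q a k * p a (suc k) ≡ 1 + p a k * q a (suc k)
  det-odd  : ∀ {k} → Odd k → p a k * q a (suc k) ≡ 1 + q a k * p a (suc k)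
  det-even zero = refl
  det-even {suc k} (suc odd) =
    determinant-step (a (suc (suc k))) (q a k) (p a k) (q a (suc k)) (p a (suc k)) (det-odd odd)
  det-odd {suc k} (suc even) =
    determinant-step (a (suc (suc k))) (p a k) (q a k) (p a (suc k)) (q a (suc k)) (det-even even)

  Recurrent : (ℕ → ℕ) → Set
  Recurrent U = ∀ j → U (suc (suc j)) ≡ a (suc (suc j)) * U (suc j) + U j

  recurrent-q : Recurrent (q a)
  recurrent-q _ = refl

  recurrent-p : Recurrent (p a)
  recurrent-p _ = refl

  recurrent-scaled : ∀ c {U} → Recurrent U → Recurrent (λ j → c * U j)
  recurrent-scaled c {U} rec j = trans (cong (c *_) (rec j)) (distribute c (a (suc (suc j))) (U (suc j)) (U j))
    where
    distribute : ∀ c A x₁ x₀ → c * (A * x₁ + x₀) ≡ A * (c * x₁) + c * x₀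
    distribute c A x₁ x₀ = solve (c ∷ A ∷ x₁ ∷ x₀ ∷ [])

  module Comparison {U V : ℕ → ℕ} (recU : Recurrent U) (recV : Recurrent V) {j : ℕ} where

    propagate-< : U j ≤ V j → U (suc j) < V (suc j) → ∀ {l} → j < l → U l < V l
    propagate-< Uj≤Vj Uj′<Vj′ {suc l} (s≤s j≤l) = proj₂ (both j≤l)
      where
      both : ∀ {l} → j ≤ l → U l ≤ V l × U (suc l) < V (suc l)
      both {l} j≤l with m≤n⇒m<n∨m≡n j≤l
      ... | inj₂ refl = Uj≤Vj , Uj′<Vj′
      both {suc l} _ | inj₁ (s≤s j≤l) with both j≤l
      ... | Ul≤Vl , Ul′<Vl′ = <⇒≤ Ul′<Vl′ , subst₂ _<_ (sym (recU l)) (sym (recV l))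
        (+-mono-<-≤ (*-monoʳ-< (a (suc (suc l))) {{>-nonZero (a-pos (suc l))}} Ul′<Vl′) Ul≤Vl)

    propagate-≤ : U j ≤ V j → U (suc j) ≤ V (suc j) → ∀ {l} → j ≤ l → U l ≤ V l
    propagate-≤ Uj≤Vj Uj′≤Vj′ j≤l = proj₁ (both j≤l)
      where
      both : ∀ {l} → j ≤ l → U l ≤ V l × U (suc l) ≤ V (suc l)
      both {l} j≤l with m≤n⇒m<n∨m≡n j≤l
      ... | inj₂ refl = Uj≤Vj , Uj′≤Vj′
      both {suc l} _ | inj₁ (s≤s j≤l) with both j≤l
      ... | Ul≤Vl , Ul′≤Vl′ = Ul′≤Vl′ , subst₂ _≤_ (sym (recU l)) (sym (recV l))
        (+-mono-≤ (*-monoʳ-≤ (a (suc (suc l))) Ul′≤Vl′) Ul≤Vl)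

  module Approximation (h : ℕ) where

    K : ℕ
    K = 2 * suc h

    P Q : ℕ
    P = p a K
    Q = q a K

    instance
      Q-nonZero : NonZero Q
      Q-nonZero = >-nonZero (q-pos K)

    open Residues P Q

    det-K : Q * p a (suc K) ≡ 1 + P * q a (suc K)
    det-K = det-even (even-double (suc h))

    coprime : Coprime Q P
    coprime = coprime-by-determinant det-K

    convergent-below : ∀ {k} → Even k → k < K → p a k * Q < q a k * P
    convergent-below {k} even k<K =
      propagate-< (≤-reflexive (*-comm (p a k) (q a k))) (≤-reflexive (sym (det-even even))) k<K
      where open Comparison (recurrent-scaled (p a k) recurrent-q) (recurrent-scaled (q a k) recurrent-p)

    convergent-above : ∀ {k} → Odd k → k < K → q a k * P < p a k * Q
    convergent-above {k} odd k<K =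
      propagate-< (≤-reflexive (*-comm (q a k) (p a k))) (≤-reflexive (sym (det-odd odd))) k<K
      where open Comparison (recurrent-scaled (q a k) recurrent-p) (recurrent-scaled (p a k) recurrent-q)

    -- Even convergents increase to α, and no m/i with i < Q lies strictly between p_K/q_K and
    -- p_{K+1}/q_{K+1} (farey-gap).
    below⇔ : ∀ m {i} → i < Q → Below a m i ⇔ m * Q < i * P
    below⇔ m {i} i<Q = mk⇔ to (λ mQ<iP → suc h , mQ<iP)
      where
      to : Below a m i → m * Q < i * P
      to (k , below) with <-cmp (2 * k) K
      ... | tri< 2k<K _ _ = cross-multiply {m} {i} {p a (2 * k)} {q a (2 * k)} {P} {Q} below
                              (<⇒≤ (convergent-below (even-double k) 2k<K))
      ... | tri≈ _ 2k≡K _ = subst (λ l → m * q a l < i * p a l) 2k≡K below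
      ... | tri> _ _ K<2k with m * Q <? i * P
      ...   | yes mQ<iP = mQ<iP
      ...   | no mQ≮iP = ⊥-elim (<⇒≱ below (propagate-≤ iP≤mQ next (<⇒≤ K<2k)))
        where
        open Comparison (recurrent-scaled i recurrent-p) (recurrent-scaled m recurrent-q)
        iP≤mQ : i * P ≤ m * Q
        iP≤mQ = ≮⇒≥ mQ≮iP
        next : i * p a (suc K) ≤ m * q a (suc K)
        next with i * p a (suc K) ≤? m * q a (suc K)
        ... | yes le = le
        ... | no nle = ⊥-elim (<⇒≱ i<Q
                         (farey-gap {m} {i} {P} {Q} {p a (suc K)} {q a (suc K)} det-K iP≤mQ (≰⇒> nle)))

    2≤K : 2 ≤ K
    2≤K = *-monoʳ-≤ 2 (s≤s z≤n)

    ρ : ℕ → ℕ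
    ρ k = ∣ q a k * P - p a k * Q ∣

    ρ-even : ∀ {k} → Even k → k < K → q a k * P ≡ p a k * Q + ρ k
    ρ-even {k} even k<K = sym (trans (cong (p a k * Q +_) (m≤n⇒∣n-m∣≡n∸m below)) (m+[n∸m]≡n below))
      where
      below : p a k * Q ≤ q a k * P
      below = <⇒≤ (convergent-below even k<K)

    ρ-odd : ∀ {k} → Odd k → k < K → p a k * Q ≡ q a k * P + ρ k
    ρ-odd {k} odd k<K = sym (trans (cong (q a k * P +_) (m≤n⇒∣m-n∣≡n∸m above)) (m+[n∸m]≡n above))
      where
      above : q a k * P ≤ p a k * Q
      above = <⇒≤ (convergent-above odd k<K)

    ρ-pos : ∀ {k} → k < K → 0 < ρ k
    ρ-pos {k} k<K with even-or-odd k
    ... | inj₁ even = gap-pos (convergent-below even k<K) (ρ-even even k<K)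
    ... | inj₂ odd  = gap-pos (convergent-above odd k<K) (ρ-odd odd k<K)

    ρ-expansion : ∀ {k} → suc k < K →
                  P ≡ p a (suc k) * ρ k + p a k * ρ (suc k) × Q ≡ q a (suc k) * ρ k + q a k * ρ (suc k)
    ρ-expansion {k} k+1<K with even-or-odd k
    ... | inj₁ even = unimodular-solve {q a k} {p a k} {q a (suc k)} {p a (suc k)} {P} {Q} {ρ k} {ρ (suc k)}
                        (ρ-even even k<K) (ρ-odd (suc even) k+1<K) (det-even even)
      where
      k<K : k < K
      k<K = <-trans (n<1+n k) k+1<K
    ... | inj₂ odd  = swap (unimodular-solve {p a k} {q a k} {p a (suc k)} {q a (suc k)} {Q} {P} {ρ k} {ρ (suc k)}
                        (ρ-odd odd k<K) (ρ-even (suc odd) k+1<K) (det-odd odd))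
      where
      k<K : k < K
      k<K = <-trans (n<1+n k) k+1<K

    ρ<Q : ∀ {k} → suc k < K → ρ k < Q
    ρ<Q {k} k+1<K = begin-strict
      ρ k                                   ≤⟨ m≤n*m (ρ k) (q a (suc k)) {{>-nonZero (q-pos (suc k))}} ⟩
      q a (suc k) * ρ k                     <⟨ m<m+n _ (*-mono-≤ (q-pos k) (ρ-pos k+1<K)) ⟩
      q a (suc k) * ρ k + q a k * ρ (suc k) ≡⟨ proj₂ (ρ-expansion k+1<K) ⟨
      Q                                     ∎
      where open ≤-Reasoning

    P<Q : P < Q
    P<Q = subst (_< Q) (trans (sym (ρ-even zero (<-≤-trans (s≤s z≤n) 2≤K))) (+-identityʳ P)) (ρ<Q 2≤K)

    residue-q-even : ∀ {k} → Even k → suc k < K → residue (q a k) ≡ ρ k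
    residue-q-even {k} even k+1<K = residue-of (q a k) {p a k} (ρ-even even (<-trans (n<1+n _) k+1<K)) (ρ<Q k+1<K)

    residue-q-odd : ∀ {k} → Odd k → suc k < K → residue (q a k) ≡ Q ∸ ρ k
    residue-q-odd {k} odd k+1<K =
      residue-of-deficit (q a k) {p a k} (sym (ρ-odd odd k<K)) (ρ-pos k<K) (<⇒≤ (ρ<Q k+1<K))
      where
      k<K : k < K
      k<K = <-trans (n<1+n k) k+1<K

    multiples-separated : ∀ {k j} → suc k < K → 0 < j → j < q a (suc k) →
                ∀ m → m * Q + ρ k ≤ j * P ⊎ j * P + ρ k ≤ m * Q
    multiples-separated {k} {j} k+1<K 0<j j<q m = subst₂ Separated (sym jP) (sym mQ) (oriented (even-or-odd k))
      where
      Separated : ℕ → ℕ → Set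
      Separated x y = y + ρ k ≤ x ⊎ x + ρ k ≤ y
      distribute : ∀ j u v w z → j * (u * v + w * z) ≡ j * u * v + j * w * z
      distribute j u v w z = solve (j ∷ u ∷ v ∷ w ∷ z ∷ [])
      jP : j * P ≡ j * p a (suc k) * ρ k + j * p a k * ρ (suc k)
      jP = trans (cong (j *_) (proj₁ (ρ-expansion k+1<K))) (distribute j _ _ _ _)
      mQ : m * Q ≡ m * q a (suc k) * ρ k + m * q a k * ρ (suc k)
      mQ = trans (cong (m *_) (proj₂ (ρ-expansion k+1<K))) (distribute m _ _ _ _)
      A B C D : ℕ
      A = j * p a (suc k)
      B = m * q a (suc k)
      C = m * q a k
      D = j * p a k
      oriented : Even k ⊎ Odd k → Separated (A * ρ k + D * ρ (suc k)) (B * ρ k + C * ρ (suc k))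
      oriented (inj₁ even) =
        unimodular-separation {q a k} {q a (suc k)} {j} {A} {B} {C} {D} {ρ k} {ρ (suc k)} 0<j j<q
                               (lattice-even j m {q a k} {p a k} {q a (suc k)} {p a (suc k)} (det-even even))
      oriented (inj₂ odd) = Sum.swap
        (unimodular-separation {q a k} {q a (suc k)} {j} {B} {A} {D} {C} {ρ k} {ρ (suc k)} 0<j j<q
                               (lattice-odd j m {q a k} {p a k} {q a (suc k)} {p a (suc k)} (det-odd odd)))

    residue-bounds : ∀ {k j} → suc k < K → 0 < j → j < q a (suc k) →
                     ρ k ≤ residue j × residue j + ρ k ≤ Q
    residue-bounds {k} {j} k+1<K 0<j j<q =
      separated⇒residue-bounds j (ρ-pos (<-trans (n<1+n k) k+1<K)) (multiples-separated k+1<K 0<j j<q)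

    XOne⇔carry : ∀ {i} → 0 < i → suc i < Q → XOne a i ⇔ carry i 1 ≡ 1
    XOne⇔carry {i} 0<i i+1<Q =
      ⇔.trans (mk⇔ to from)
     (⇔.trans (multiple-between⇔ i (residue-nonzero coprime i 0<i i<Q))
              (⇔.sym (subst (λ x → carry i 1 ≡ 1 ⇔ Q < residue i + x) (residue-one P<Q)
                            (carry≡1⇔ i 1 (residue-nonzero coprime (i + 1) (≤-trans 0<i (m≤m+n i 1))
                                                            (≤-<-trans (≤-reflexive (+-comm i 1)) i+1<Q))))))
      where
      i<Q : i < Q
      i<Q = <-trans (n<1+n i) i+1<Q
      to : XOne a i → ∃ λ m → m * Q < suc i * P × ¬ m * Q < i * P
      to (m , below′ , not-below) =
        m , Equivalence.to (below⇔ m i+1<Q) below′ , not-below ∘ Equivalence.from (below⇔ m i<Q)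
      from : (∃ λ m → m * Q < suc i * P × ¬ m * Q < i * P) → XOne a i
      from (m , mQ<iP+P , mQ≮iP) =
        m , Equivalence.from (below⇔ m i+1<Q) mQ<iP+P , mQ≮iP ∘ Equivalence.to (below⇔ m i<Q)

    XOne-encoded : ∀ {n} → suc n < Q → Encodes (XOne a) n
    XOne-encoded n+1<Q 0<i i≤n = XOne⇔carry 0<i (≤-<-trans (s≤s i≤n) n+1<Q)

    carry-q-even : ∀ {t j} → Even t → suc t < K → 0 < j → j < q a (suc t) → j + q a t < Q →
                   carry j (q a t) ≡ 0
    carry-q-even {t} {j} even t+1<K 0<j j<q j+q<Q = carry≡0 j (q a t) (≤∧≢⇒< (begin
      residue j + residue (q a t) ≡⟨ cong (residue j +_) (residue-q-even even t+1<K) ⟩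
      residue j + ρ t             ≤⟨ proj₂ (residue-bounds t+1<K 0<j j<q) ⟩
      Q                           ∎)
      (residue-nonzero coprime (j + q a t) (≤-trans 0<j (m≤m+n j _)) j+q<Q ∘ residue-+≡0 j (q a t)))
      where open ≤-Reasoning

    carry-q-odd : ∀ {t j} → Odd t → suc t < K → 0 < j → j < q a (suc t) → carry j (q a t) ≡ 1
    carry-q-odd {t} {j} odd t+1<K 0<j j<q = carry≡1 j (q a t) (begin
      Q                           ≡⟨ m+[n∸m]≡n (<⇒≤ (ρ<Q t+1<K)) ⟨
      ρ t + (Q ∸ ρ t)             ≤⟨ +-monoˡ-≤ (Q ∸ ρ t) (proj₁ (residue-bounds t+1<K 0<j j<q)) ⟩
      residue j + (Q ∸ ρ t)       ≡⟨ cong (residue j +_) (residue-q-odd odd t+1<K) ⟨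
      residue j + residue (q a t) ∎)
      where open ≤-Reasoning

    q-period : ∀ {t n} → suc t < K → suc n < Q → q a t ≤ n → 2 + n ≤ q a (suc t) + q a t →
               Period (XOne a) n (q a t)
    q-period {t} {n} t+1<K n+1<Q q≤n n+2≤q+q = constant-carry (even-or-odd t)
      where
      j<q : ∀ {j} → j + q a t ≤ suc n → j < q a (suc t)
      j<q j+q≤n+1 = +-cancelʳ-< (q a t) _ _ (≤-trans (s≤s j+q≤n+1) n+2≤q+q)
      constant-carry : Even t ⊎ Odd t → Period (XOne a) n (q a t)
      constant-carry (inj₁ even) = period-from-carries (XOne-encoded n+1<Q) (q-pos t) q≤n
        (λ 0<j j+q≤n+1 → carry-q-even even t+1<K 0<j (j<q j+q≤n+1) (≤-<-trans j+q≤n+1 n+1<Q))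
      constant-carry (inj₂ odd) = period-from-carries (XOne-encoded n+1<Q) (q-pos t) q≤n
        (λ 0<j j+q≤n+1 → carry-q-odd odd t+1<K 0<j (j<q j+q≤n+1))

    -- A period p < q_{s+1} would give j = q_{s+1} − p and j + p = q_{s+1} the same carry with
    -- q_s, but by the parity of s exactly one of these carries is 1.
    no-short-period : ∀ {s n p} → suc (suc s) < K → suc n < Q → q a (suc s) + q a s ≤ suc n →
                      0 < p → p < q a (suc s) → ¬ Period (XOne a) n p
    no-short-period {s} {n} {p} s+2<K n+1<Q q+q≤n+1 0<p p<q period = differ (even-or-odd s)
      where
      s+1<K : suc s < K
      s+1<K = <-trans (n<1+n _) s+2<K
      q+q<Q : q a (suc s) + q a s < Q
      q+q<Q = ≤-<-trans q+q≤n+1 n+1<Q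
      j : ℕ
      j = q a (suc s) ∸ p
      j+p≡q : j + p ≡ q a (suc s)
      j+p≡q = m∸n+n≡m (<⇒≤ p<q)
      0<j : 0 < j
      0<j = m<n⇒0<n∸m p<q
      j<q : j < q a (suc s)
      j<q = subst (j <_) j+p≡q (m<m+n j 0<p)
      q<q : q a s < q a (suc (suc s))
      q<q = <-≤-trans (m<n+m (q a s) (q-pos (suc s))) (q+q≤q s)
      shifted : carry (q a s) (q a (suc s)) ≡ carry j (q a s)
      shifted = trans (carry-comm (q a s) (q a (suc s)))
        (subst (λ x → carry x (q a s) ≡ carry j (q a s)) j+p≡q
          (period-shifts-carry (XOne-encoded n+1<Q) period (q a s) 0<j
            (≤-trans (≤-reflexive (trans (xy∙z≈xz∙y j (q a s) p) (cong (_+ q a s) j+p≡q))) q+q≤n+1)))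
      differ : Even s ⊎ Odd s → ⊥
      differ (inj₁ even) = 1+n≢0 (begin
        1                           ≡⟨ carry-q-odd (suc even) s+2<K (q-pos s) q<q ⟨
        carry (q a s) (q a (suc s)) ≡⟨ shifted ⟩
        carry j (q a s)             ≡⟨ carry-q-even even s+1<K 0<j j<q
                                         (≤-<-trans (+-monoˡ-≤ (q a s) (<⇒≤ j<q)) q+q<Q) ⟩
        0                           ∎)
        where open ≡-Reasoning
      differ (inj₂ odd) = 1+n≢0 (begin
        1                           ≡⟨ carry-q-odd odd s+1<K 0<j j<q ⟨
        carry j (q a s)             ≡⟨ shifted ⟨
        carry (q a s) (q a (suc s)) ≡⟨ carry-q-even (suc odd) s+2<K (q-pos s) q<q
                                         (≤-<-trans (≤-reflexive (+-comm (q a s) (q a (suc s)))) q+q<Q) ⟩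
        0                           ∎)
        where open ≡-Reasoning

  large-index : ∀ n t → suc (suc t) < 2 * suc (suc (n + t)) × suc n < q a (2 * suc (suc (n + t)))
  large-index n t =
    ≤-<-trans (s≤s (s≤s (m≤n+m t n))) (m<m+n H (s≤s z≤n)) ,
    ≤-trans (s≤s (s≤s (m≤m+n n t))) (≤-trans (m≤m+n H (H + 0)) (n≤q (2 * H)))
    where
    H : ℕ
    H = suc (suc (n + t))

  q-period : ∀ {t n} → q a t ≤ n → 2 + n ≤ q a (suc t) + q a t → Period (XOne a) n (q a t)
  q-period {t} {n} = Approximation.q-period (suc (n + t)) (<-trans (n<1+n _) (proj₁ (large-index n t)))
                                                          (proj₂ (large-index n t))

  no-short-period : ∀ {s n p} → q a (suc s) + q a s ≤ suc n → 0 < p → p < q a (suc s) →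
                    ¬ Period (XOne a) n p
  no-short-period {s} {n} = Approximation.no-short-period (suc (n + s)) (proj₁ (large-index n s))
                                                                      (proj₂ (large-index n s))

module Ostrowski (a : ℕ → ℕ) (a-pos : ∀ i → 1 ≤ a (suc i)) (d : ℕ → ℕ) where
  open Convergents a a-pos

  maxDigit : ℕ → ℕ
  maxDigit zero = a 1 ∸ 1
  maxDigit (suc i) = a (suc (suc i))

  digitSum : ℕ → ℕ
  digitSum t = sumBelow (λ i → d i * q a i) t

  value : ℕ → ℕ → ℕ
  value t c = digitSum t + c * q a t

  record Lazy (t : ℕ) : Set where
    field
      bounded : ∀ {i} → i < t → d i ≤ maxDigit i
      full-before-zero : ∀ {i} → suc i < t → d (suc i) ≡ 0 → d i ≡ maxDigit i

  lazy-pred : ∀ {t} → Lazy (suc t) → Lazy t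
  lazy-pred lazy = record
    { bounded = λ i<t → Lazy.bounded lazy (<-trans i<t (n<1+n _))
    ; full-before-zero = λ i+1<t → Lazy.full-before-zero lazy (<-trans i+1<t (n<1+n _))
    }

  lower-bound : ∀ s → Lazy (suc s) → q a s ≤ suc (digitSum (suc s))
  lower-bound s lazy with d s ≟ 0
  ... | no ds≢0 = begin
    q a s                  ≤⟨ m≤n*m (q a s) (d s) {{≢-nonZero ds≢0}} ⟩
    d s * q a s            ≤⟨ m≤n+m _ (digitSum s) ⟩
    digitSum (suc s)       ≤⟨ n≤1+n _ ⟩
    suc (digitSum (suc s)) ∎
    where open ≤-Reasoning
  lower-bound zero lazy | yes _ = s≤s z≤n
  lower-bound (suc zero) lazy | yes d₁≡0 = begin
    a 1                               ≡⟨ m∸n+n≡m (a-pos 0) ⟨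
    a 1 ∸ 1 + 1                       ≡⟨ cong (_+ 1) (Lazy.full-before-zero lazy (n<1+n 1) d₁≡0) ⟨
    d 0 + 1                           ≡⟨ +-comm (d 0) 1 ⟩
    suc (d 0)                         ≡⟨ cong suc (*-identityʳ (d 0)) ⟨
    suc (d 0 * 1)                     ≤⟨ s≤s (m≤m+n (d 0 * 1) (d 1 * a 1)) ⟩
    suc (digitSum 2)                  ∎
    where open ≤-Reasoning
  lower-bound (suc (suc s)) lazy | yes d₂≡0 = begin
    a (suc (suc s)) * q a (suc s) + q a s
      ≡⟨ cong (λ x → x * q a (suc s) + q a s) (Lazy.full-before-zero lazy (n<1+n _) d₂≡0) ⟨
    d (suc s) * q a (suc s) + q a s
      ≤⟨ +-monoʳ-≤ (d (suc s) * q a (suc s)) (lower-bound s (lazy-pred (lazy-pred lazy))) ⟩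
    d (suc s) * q a (suc s) + suc (digitSum (suc s))
      ≡⟨ trans (+-suc _ _) (cong suc (+-comm _ (digitSum (suc s)))) ⟩
    suc (digitSum (suc (suc s)))
      ≤⟨ s≤s (m≤m+n _ _) ⟩
    suc (digitSum (suc (suc (suc s)))) ∎
    where open ≤-Reasoning

  upper-bound : ∀ t {c} → (∀ {i} → i < t → d i ≤ maxDigit i) → c ≤ maxDigit t →
                2 + value t c ≤ q a (suc t) + q a t
  upper-bound zero {c} _ c≤max = begin
    2 + (0 + c * 1) ≡⟨ cong (2 +_) (*-identityʳ c) ⟩
    2 + c           ≤⟨ s≤s (≤-trans (s≤s c≤max) (≤-reflexive (+-comm 1 (a 1 ∸ 1)))) ⟩
    1 + (a 1 ∸ 1 + 1) ≡⟨ cong suc (m∸n+n≡m (a-pos 0)) ⟩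
    1 + a 1         ≡⟨ +-comm 1 (a 1) ⟩
    a 1 + 1         ∎
    where open ≤-Reasoning
  upper-bound (suc t) {c} bounded c≤max = begin
    2 + (digitSum t + d t * q a t + c * q a (suc t))
      ≡⟨ +-assoc 2 (value t (d t)) (c * q a (suc t)) ⟨
    2 + value t (d t) + c * q a (suc t)
      ≤⟨ +-mono-≤ (upper-bound t (λ i<t → bounded (<-trans i<t (n<1+n t))) (bounded (n<1+n t)))
                  (*-monoˡ-≤ (q a (suc t)) c≤max) ⟩
    q a (suc t) + q a t + a (suc (suc t)) * q a (suc t)
      ≡⟨ xy∙z≈zy∙x (q a (suc t)) (q a t) _ ⟩
    q a (suc (suc t)) + q a (suc t) ∎
    where open ≤-Reasoning

  Multiple : ℕ → ℕ → ℕ → Set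
  Multiple c x p = ∃ λ e → 1 ≤ e × e ≤ c × p ≡ e * x

  -- InAᵗ t c p: p lies in the set A of the digits d₀, …, d_{t−1} followed by the top digit c.
  InAᵗ : ℕ → ℕ → ℕ → Set
  InAᵗ zero c p = Multiple c (q a 0) p
  InAᵗ (suc t) c p =
    Multiple c (q a (suc t)) p ⊎ ∃ λ p′ → InAᵗ t (d t) p′ × p ≡ c * q a (suc t) + p′

  multiple-in-A : ∀ t {c p} → Multiple c (q a t) p → InAᵗ t c p
  multiple-in-A zero = λ multiple → multiple
  multiple-in-A (suc t) = inj₁

  bump-multiple : ∀ {c x p} → Multiple c x p → Multiple (suc c) x (x + p)
  bump-multiple (e , 1≤e , e≤c , refl) = suc e , s≤s z≤n , s≤s e≤c , refl

  bump : ∀ t {c p} → InAᵗ t c p → InAᵗ t (suc c) (q a t + p)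
  bump zero multiple = bump-multiple multiple
  bump (suc t) (inj₁ multiple) = inj₁ (bump-multiple multiple)
  bump (suc t) {c} (inj₂ (p′ , inA , refl)) =
    inj₂ (p′ , inA , sym (+-assoc (q a (suc t)) (c * q a (suc t)) p′))

  tailSum : ℕ → ℕ → ℕ
  tailSum j t = sumBelow (λ k → d (suc j + k) * q a (suc j + k)) (t ∸ j)

  tailSum-self : ∀ j → tailSum j j ≡ 0
  tailSum-self j rewrite n∸n≡0 j = refl

  tailSum-suc : ∀ {j t} → j ≤ t → tailSum j (suc t) ≡ tailSum j t + d (suc t) * q a (suc t)
  tailSum-suc {j} {t} j≤t rewrite +-∸-assoc 1 j≤t | m+[n∸m]≡n j≤t = refl

  InAᵗ⇒InA : ∀ t {p} → InAᵗ t (d t) p → InA a t d p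
  InAᵗ⇒InA zero (e , 1≤e , e≤d , refl) = 0 , e , z≤n , 1≤e , e≤d , sym (+-identityʳ (e * 1))
  InAᵗ⇒InA (suc t) (inj₁ (e , 1≤e , e≤d , refl)) =
    suc t , e , ≤-refl , 1≤e , e≤d ,
    sym (trans (cong (e * q a (suc t) +_) (tailSum-self (suc t))) (+-identityʳ _))
  InAᵗ⇒InA (suc t) (inj₂ (p′ , inA , refl)) with InAᵗ⇒InA t inA
  ... | j , e , j≤t , 1≤e , e≤d , refl =
    j , e , ≤-trans j≤t (n≤1+n t) , 1≤e , e≤d ,
    trans (x∙yz≈y∙zx (d (suc t) * q a (suc t)) (e * q a j) (tailSum j t))
          (cong (e * q a j +_) (sym (tailSum-suc j≤t)))

  q≤value : ∀ t c → q a t ≤ value t (suc c)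
  q≤value t c = ≤-trans (m≤m+n (q a t) (c * q a t)) (m≤n+m _ (digitSum t))

  value∸q : ∀ t c → value t (suc c) ∸ q a t ≡ value t c
  value∸q t c = trans (cong (_∸ q a t) (x∙yz≈y∙xz (digitSum t) (q a t) (c * q a t))) (m+n∸m≡n (q a t) _)

  q+q≤value : ∀ s c → Lazy (suc s) → q a (suc s) + q a s ≤ suc (value (suc s) (suc c))
  q+q≤value s c lazy = begin
    q a (suc s) + q a s                             ≤⟨ +-mono-≤ (m≤m+n _ _) (lower-bound s lazy) ⟩
    suc c * q a (suc s) + suc (digitSum (suc s))    ≡⟨ +-suc _ _ ⟩
    suc (suc c * q a (suc s) + digitSum (suc s))    ≡⟨ cong suc (+-comm _ (digitSum (suc s))) ⟩
    suc (value (suc s) (suc c))                     ∎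
    where open ≤-Reasoning

  periods-in-A : ∀ t c → Lazy t → c ≤ maxDigit t →
                 ∀ {p} → Period (XOne a) (value t c) p → InAᵗ t c p
  periods-in-A zero zero _ _ (1≤p , p≤0 , _) = ⊥-elim (<⇒≱ 1≤p p≤0)
  periods-in-A (suc t) zero lazy _ {p} period =
    inj₂ (p , periods-in-A t (d t) (lazy-pred lazy) (Lazy.bounded lazy (n<1+n t))
                (subst (λ n → Period (XOne a) n p) (+-identityʳ _) period) , refl)
  periods-in-A t (suc c) lazy c<max {p} period@(1≤p , _) with <-cmp p (q a t)
  ... | tri≈ _ refl _ = multiple-in-A t (1 , ≤-refl , s≤s z≤n , sym (*-identityˡ (q a t)))
  ... | tri> _ _ q<p = subst (InAᵗ t (suc c)) (m+[n∸m]≡n (<⇒≤ q<p))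
                         (bump t (periods-in-A t c lazy (≤-trans (n≤1+n c) c<max) remainder))
    where
    remainder : Period (XOne a) (value t c) (p ∸ q a t)
    remainder = subst (λ n → Period (XOne a) n (p ∸ q a t)) (value∸q t c)
      (period-difference (q-period {t} {value t (suc c)} (q≤value t c) (upper-bound t (Lazy.bounded lazy) c<max))
                         period q<p)
  periods-in-A zero (suc c) _ _ (1≤p , _) | tri< p<1 _ _ = ⊥-elim (<⇒≱ p<1 1≤p)
  periods-in-A (suc s) (suc c) lazy _ period@(1≤p , _) | tri< p<q _ _ =
    ⊥-elim (no-short-period {s} {value (suc s) (suc c)} (q+q≤value s c lazy) 1≤p p<q period)

  digit≤maxDigit : ∀ {n t} → LazyOstrowski a n t d → ∀ {i} → i ≤ t → d i ≤ maxDigit i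
  digit≤maxDigit (_ , _ , d₀<a₁ , _) {zero} _ = ∸-monoˡ-≤ 1 d₀<a₁
  digit≤maxDigit (_ , _ , _ , bounded , _) {suc i} i+1≤t = bounded (suc i) (s≤s z≤n) i+1≤t

  lazy-of-LazyOstrowski : ∀ {n t} → LazyOstrowski a n t d → Lazy t
  lazy-of-LazyOstrowski ostrowski@(_ , _ , _ , _ , full , full₁) = record
    { bounded = digit≤maxDigit ostrowski ∘ <⇒≤
    ; full-before-zero = λ { {zero} 1<t → full₁ (<⇒≤ 1<t)
                           ; {suc i} i+2<t → full (suc (suc i)) (s≤s (s≤s z≤n)) (<⇒≤ i+2<t) }
    }

lemma10 : (a : ℕ → ℕ) → (∀ i → 1 ≤ a (suc i)) →
    (n : ℕ) → 1 ≤ n → (t : ℕ) → (d : ℕ → ℕ) → LazyOstrowski a n t d →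
    (per : ℕ) → IsPeriodOfPrefix a n per → InA a t d per
lemma10 a a-pos n _ t d ostrowski per period =
  InAᵗ⇒InA t (periods-in-A t (d t) (lazy-of-LazyOstrowski ostrowski) (digit≤maxDigit ostrowski ≤-refl)
                             (subst (λ m → Period (XOne a) m per) (sym (proj₁ ostrowski)) period))
  where open Ostrowski a a-pos d
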